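{- Let $H$ be any graph of order $n\ge 1$ and let $H(3)$ be the graph obtained from $H$ by identifying each vertex of $H$ with an end vertex of its own copy of the path $P_3$. Then $$D_t(H(3),x)=x^{2n}(x+2)^n.$$
   Context: All graphs are finite and simple. For a graph $G=(V,E)$, a set $D\subseteq V$ is a total dominating set if every vertex of $V$ (including those in $D$) is adjacent to some vertex of $D$. Let $d_t(G,i)$ be the number of total dominating sets of $G$ of cardinality $i$; the total domination polynomial is $D_t(G,x)=\sum_{i=1}^{|V|} d_t(G,i)x^i$. The graph $H(3)$: if $V(H)=\{v_1,\dots,v_n\}$, add $2n$ new vertices $a_1,b_1,\dots,a_n,b_n$ and the edges $v_ia_i$ and $a_ib_i$ for $i=1,\dots,n$ (so each $v_i$ is the end of a path $v_i a_i b_i$). -}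

module Defs where

open import Data.Nat using (ℕ; zero; suc; _+_; _*_)
open import Data.Bool using (Bool; true; false; _∧_; _∨_; if_then_else_; T)
open import Data.Fin using (Fin; zero; suc; splitAt; _↑ˡ_; _↑ʳ_; _≟_)
open import Data.Sum using (_⊎_; inj₁; inj₂)
open import Data.Vec using (Vec; []; _∷_; lookup; tabulate)
open import Data.List using (List; []; _∷_; map; _++_)
open import Relation.Binary.PropositionalEquality using (_≡_; refl) renaming (sym to ≡sym)
open import Relation.Nullary using (yes; no)
open import Data.Empty using (⊥-elim)
open import Relation.Nullary.Decidable using (⌊_⌋)

record Graph (m : ℕ) : Set where
  field
    adj   : Fin m → Fin m → Bool
    sym   : ∀ u v → adj u v ≡ adj v u
    irrefl : ∀ v → adj v v ≡ false
open Graph public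

Subset : ℕ → Set
Subset m = Vec Bool m

allSubsets : (m : ℕ) → List (Subset m)
allSubsets zero = [] ∷ []
allSubsets (suc m) = map (false ∷_) (allSubsets m) ++ map (true ∷_) (allSubsets m)

anyFin : {m : ℕ} → (Fin m → Bool) → Bool
anyFin {zero} f = false
anyFin {suc m} f = f zero ∨ anyFin (λ i → f (suc i))

allFin : {m : ℕ} → (Fin m → Bool) → Bool
allFin {zero} f = true
allFin {suc m} f = f zero ∧ allFin (λ i → f (suc i))

card : {m : ℕ} → Subset m → ℕ
card [] = 0
card (true ∷ s) = suc (card s)
card (false ∷ s) = card s

isTotalDominating : {m : ℕ} → Graph m → Subset m → Bool
isTotalDominating G D = allFin (λ v → anyFin (λ u → lookup D u ∧ adj G v u))

countB : {A : Set} → (A → Bool) → List A → ℕ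
countB p [] = 0
countB p (x ∷ xs) = if p x then suc (countB p xs) else countB p xs

dt : {m : ℕ} → Graph m → ℕ → ℕ
dt {m} G i = countB (λ D → ⌊ card D Data.Nat.≟ i ⌋ ∧ isTotalDominating G D) (allSubsets m)
  where import Data.Nat

-- Polynomials with ℕ coefficients as coefficient lists (constant term first)
Poly : Set
Poly = List ℕ

coeff : Poly → ℕ → ℕ
coeff [] i = 0
coeff (a ∷ p) zero = a
coeff (a ∷ p) (suc i) = coeff p i

_⊕_ : Poly → Poly → Poly
[] ⊕ q = q
(a ∷ p) ⊕ [] = a ∷ p
(a ∷ p) ⊕ (b ∷ q) = (a + b) ∷ (p ⊕ q)

scale : ℕ → Poly → Poly
scale c = map (c *_)

_⊗_ : Poly → Poly → Poly
[] ⊗ q = []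
(a ∷ p) ⊗ q = scale a q ⊕ (0 ∷ (p ⊗ q))

_^ₚ_ : Poly → ℕ → Poly
p ^ₚ zero = 1 ∷ []
p ^ₚ suc k = p ⊗ (p ^ₚ k)

X : Poly
X = 0 ∷ 1 ∷ []

Dt : {m : ℕ} → Graph m → Poly
Dt {m} G = tabulate {n = suc m} (λ i → dt G (Data.Fin.toℕ i)) |> Data.Vec.toList
  where
  import Data.Vec
  _|>_ : ∀ {A B : Set} → A → (A → B) → B
  x |> f = f x

-- H(3): vertex set Fin (n + (n + n)); block 0 = v_i, block 1 = a_i, block 2 = b_i.
-- Edges: those of H on the v's, plus v_i a_i and a_i b_i.
data Kind (n : ℕ) : Set where
  V A B : Fin n → Kind n

kind : {n : ℕ} → Fin (n + (n + n)) → Kind n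
kind {n} x with splitAt n x
... | inj₁ i = V i
... | inj₂ y with splitAt n y
...   | inj₁ i = A i
...   | inj₂ i = B i

eqF : {n : ℕ} → Fin n → Fin n → Bool
eqF i j = ⌊ i ≟ j ⌋

adjK : {n : ℕ} → Graph n → Kind n → Kind n → Bool
adjK H (V i) (V j) = adj H i j
adjK H (V i) (A j) = eqF i j
adjK H (A i) (V j) = eqF i j
adjK H (A i) (B j) = eqF i j
adjK H (B i) (A j) = eqF i j
adjK H _ _ = false

eqF-sym : {n : ℕ} (i j : Fin n) → eqF i j ≡ eqF j i
eqF-sym i j with i ≟ j | j ≟ i
... | yes _ | yes _ = refl
... | no _ | no _ = refl
... | yes p | no q = ⊥-elim (q (≡sym p))
... | no p | yes q = ⊥-elim (p (≡sym q))

adjK-sym : {n : ℕ} (H : Graph n) (x y : Kind n) → adjK H x y ≡ adjK H y x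
adjK-sym H (V i) (V j) = sym H i j
adjK-sym H (V i) (A j) = eqF-sym i j
adjK-sym H (V i) (B j) = refl
adjK-sym H (A i) (V j) = eqF-sym i j
adjK-sym H (A i) (A j) = refl
adjK-sym H (A i) (B j) = eqF-sym i j
adjK-sym H (B i) (V j) = refl
adjK-sym H (B i) (A j) = eqF-sym i j
adjK-sym H (B i) (B j) = refl

adjK-irr : {n : ℕ} (H : Graph n) (x : Kind n) → adjK H x x ≡ false
adjK-irr H (V i) = irrefl H i
adjK-irr H (A i) = refl
adjK-irr H (B i) = refl

H3 : {n : ℕ} → Graph n → Graph (n + (n + n))
H3 H = record
  { adj = λ x y → adjK H (kind x) (kind y)
  ; sym = λ x y → adjK-sym H (kind x) (kind y)
  ; irrefl = λ x → adjK-irr H (kind x) }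

-- A subset of H(3) is a triple (v, a, b) of characteristic vectors of the three vertex blocks.
-- It is totally dominating iff every a_i is chosen and at least one of v_i, b_i is: b_i has a_i
-- as its only neighbour, a_i needs v_i or b_i, and v_i is then dominated by a_i whatever H is.
-- The condition is independent across i, with local choices {a,b}, {v,a}, {v,a,b} contributing
-- x² + x² + x³, so the generating function is (x²(x + 2))ⁿ.
module Submission where

open import Defs hiding (sym)
open import Data.Nat using (ℕ; zero; suc; _+_; _*_; _≥_; _≤_; _<_; _≡ᵇ_; _≟_; z≤n; s≤s)
open import Data.Nat.Properties
  using (+-identityʳ; *-zeroʳ; *-identityˡ; *-distribˡ-+; *-suc; ≤-<-trans; m≤n⇒m≤1+n;
         +-commutativeSemigroup; *-commutativeSemigroup)
open import Data.Nat.Tactic.RingSolver using (solve-∀)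
open import Algebra.Properties.CommutativeSemigroup +-commutativeSemigroup using (interchange)
open import Algebra.Properties.CommutativeSemigroup *-commutativeSemigroup using (x∙yz≈y∙xz)
open import Data.Bool using (Bool; true; false; _∧_; _∨_; if_then_else_)
open import Data.Bool.Properties using (∧-assoc; ∨-assoc; ∧-zeroʳ; ∧-identityʳ; ∨-identityʳ; ∨-zeroʳ)
open import Data.Fin using (Fin; zero; suc; _↑ˡ_; _↑ʳ_; toℕ)
open import Data.Fin.Properties using (splitAt-↑ˡ; splitAt-↑ʳ)
open import Data.Vec using ([]; _∷_; lookup; _++_; tabulate; toList)
open import Data.Vec.Properties using (lookup-++ˡ; lookup-++ʳ)
open import Data.List using ([]; _∷_; map) renaming (_++_ to _++ₗ_)
open import Relation.Nullary.Decidable using (isYes≗does; ⌊⌋-map′)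
open import Relation.Binary.PropositionalEquality
open ≡-Reasoning

-- Coefficient sequences

Seq : Set
Seq = ℕ → ℕ

x·_ : Seq → Seq
(x· f) zero    = 0
(x· f) (suc i) = f i

x^_·_ : ℕ → Seq → Seq
x^ zero  · f = f
x^ suc k · f = x· (x^ k · f)

x²[x+2]·_ : Seq → Seq
x²[x+2]· f = x^ 2 · (λ i → 2 * f i + (x· f) i)

⟦_⟧ : Bool → ℕ
⟦ b ⟧ = if b then 1 else 0

δ : ℕ → Seq
δ c i = ⟦ c ≡ᵇ i ⟧

x·-cong : ∀ {f g} → f ≗ g → x· f ≗ x· g
x·-cong f≗g zero    = refl
x·-cong f≗g (suc i) = f≗g i

x^-cong : ∀ k {f g} → f ≗ g → x^ k · f ≗ x^ k · g
x^-cong zero    f≗g = f≗g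
x^-cong (suc k) f≗g = x·-cong (x^-cong k f≗g)

x^-+ : ∀ k l f → x^ (k + l) · f ≡ x^ k · (x^ l · f)
x^-+ zero    l f = refl
x^-+ (suc k) l f = cong x·_ (x^-+ k l f)

x^-x· : ∀ k f → x^ k · (x· f) ≡ x· (x^ k · f)
x^-x· zero    f = refl
x^-x· (suc k) f = cong x·_ (x^-x· k f)

x^-linear : ∀ k c f g i → (x^ k · (λ j → c * f j + g j)) i ≡ c * (x^ k · f) i + (x^ k · g) i
x^-linear zero    c f g i       = refl
x^-linear (suc k) c f g zero    = cong (_+ 0) (sym (*-zeroʳ c))
x^-linear (suc k) c f g (suc i) = x^-linear k c f g i

x^-*ʳ : ∀ k f c i → (x^ k · f) i * c ≡ (x^ k · (λ j → f j * c)) i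
x^-*ʳ zero    f c i       = refl
x^-*ʳ (suc k) f c zero    = refl
x^-*ʳ (suc k) f c (suc i) = x^-*ʳ k f c i

δ-+ : ∀ k c → δ (k + c) ≗ x^ k · δ c
δ-+ zero    c i       = refl
δ-+ (suc k) c zero    = refl
δ-+ (suc k) c (suc i) = δ-+ k c i

-- Coefficients of products of polynomials

infix 4 _≈ₚ_
_≈ₚ_ : Poly → Poly → Set
p ≈ₚ q = coeff p ≗ coeff q

coeff-scale : ∀ c p i → coeff (scale c p) i ≡ c * coeff p i
coeff-scale c []      i       = sym (*-zeroʳ c)
coeff-scale c (a ∷ p) zero    = refl
coeff-scale c (a ∷ p) (suc i) = coeff-scale c p i

coeff-⊕ : ∀ p q i → coeff (p ⊕ q) i ≡ coeff p i + coeff q i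
coeff-⊕ []      q       i       = refl
coeff-⊕ (a ∷ p) []      i       = sym (+-identityʳ _)
coeff-⊕ (a ∷ p) (b ∷ q) zero    = refl
coeff-⊕ (a ∷ p) (b ∷ q) (suc i) = coeff-⊕ p q i

coeff-∷⊗ : ∀ a p q i → coeff ((a ∷ p) ⊗ q) i ≡ a * coeff q i + (x· coeff (p ⊗ q)) i
coeff-∷⊗ a p q i = begin
  coeff (scale a q ⊕ (0 ∷ (p ⊗ q))) i            ≡⟨ coeff-⊕ (scale a q) (0 ∷ (p ⊗ q)) i ⟩
  coeff (scale a q) i + coeff (0 ∷ (p ⊗ q)) i    ≡⟨ cong₂ _+_ (coeff-scale a q i) (coeff-x· (p ⊗ q) i) ⟩
  a * coeff q i + (x· coeff (p ⊗ q)) i           ∎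
  where
  coeff-x· : ∀ r → coeff (0 ∷ r) ≗ x· coeff r
  coeff-x· r zero    = refl
  coeff-x· r (suc i) = refl

⊗-zeroˡ : ∀ p q → p ≈ₚ [] → p ⊗ q ≈ₚ []
⊗-zeroˡ []      q p≈0 i       = refl
⊗-zeroˡ (a ∷ p) q p≈0 zero    =
  trans (coeff-∷⊗ a p q 0) (cong (λ c → c * coeff q 0 + 0) (p≈0 0))
⊗-zeroˡ (a ∷ p) q p≈0 (suc i) =
  trans (coeff-∷⊗ a p q (suc i))
        (cong₂ (λ c s → c * coeff q (suc i) + s) (p≈0 0) (⊗-zeroˡ p q (λ j → p≈0 (suc j)) i))

⊗-congˡ : ∀ p p′ q → p ≈ₚ p′ → p ⊗ q ≈ₚ p′ ⊗ q
⊗-congˡ []      p′       q p≈p′ i = sym (⊗-zeroˡ p′ q (λ j → sym (p≈p′ j)) i)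
⊗-congˡ (a ∷ p) []       q p≈p′ i = ⊗-zeroˡ (a ∷ p) q p≈p′ i
⊗-congˡ (a ∷ p) (b ∷ p′) q p≈p′ i = begin
  coeff ((a ∷ p) ⊗ q) i                    ≡⟨ coeff-∷⊗ a p q i ⟩
  a * coeff q i + (x· coeff (p ⊗ q)) i     ≡⟨ cong₂ (λ c s → c * coeff q i + s) (p≈p′ 0)
                                                (x·-cong (⊗-congˡ p p′ q (λ j → p≈p′ (suc j))) i) ⟩
  b * coeff q i + (x· coeff (p′ ⊗ q)) i    ≡⟨ sym (coeff-∷⊗ b p′ q i) ⟩
  coeff ((b ∷ p′) ⊗ q) i                   ∎

⊗-identityˡ : ∀ q → (1 ∷ []) ⊗ q ≈ₚ q
⊗-identityˡ q i = begin
  coeff ((1 ∷ []) ⊗ q) i              ≡⟨ coeff-∷⊗ 1 [] q i ⟩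
  1 * coeff q i + (x· (λ _ → 0)) i    ≡⟨ cong (1 * coeff q i +_) (x·-zero i) ⟩
  1 * coeff q i + 0                   ≡⟨ +-identityʳ _ ⟩
  1 * coeff q i                       ≡⟨ *-identityˡ _ ⟩
  coeff q i                           ∎
  where
  x·-zero : ∀ i → (x· (λ _ → 0)) i ≡ 0
  x·-zero zero    = refl
  x·-zero (suc i) = refl

X⊗ : ∀ p → X ⊗ p ≈ₚ 0 ∷ p
X⊗ p zero    = coeff-∷⊗ 0 (1 ∷ []) p 0
X⊗ p (suc i) = trans (coeff-∷⊗ 0 (1 ∷ []) p (suc i)) (⊗-identityˡ p i)

X^⊗ : ∀ k q → coeff ((X ^ₚ k) ⊗ q) ≗ x^ k · coeff q
X^⊗ zero    q   = ⊗-identityˡ q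
X^⊗ (suc k) q i = begin
  coeff ((X ⊗ (X ^ₚ k)) ⊗ q) i     ≡⟨ ⊗-congˡ (X ⊗ (X ^ₚ k)) (0 ∷ (X ^ₚ k)) q (X⊗ (X ^ₚ k)) i ⟩
  coeff ((0 ∷ (X ^ₚ k)) ⊗ q) i     ≡⟨ coeff-∷⊗ 0 (X ^ₚ k) q i ⟩
  (x· coeff ((X ^ₚ k) ⊗ q)) i      ≡⟨ x·-cong (X^⊗ k q) i ⟩
  (x^ suc k · coeff q) i           ∎

[X+2]⊗ : ∀ q i → coeff ((X ⊕ (2 ∷ [])) ⊗ q) i ≡ 2 * coeff q i + (x· coeff q) i
[X+2]⊗ q i = trans (coeff-∷⊗ 2 (1 ∷ []) q i) (cong (2 * coeff q i +_) (x·-cong (⊗-identityˡ q) i))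

x²ⁿ[x+2]ⁿ : ℕ → Seq
x²ⁿ[x+2]ⁿ n = coeff ((X ^ₚ (2 * n)) ⊗ ((X ⊕ (2 ∷ [])) ^ₚ n))

x²ⁿ[x+2]ⁿ-suc : ∀ n → x²ⁿ[x+2]ⁿ (suc n) ≗ x²[x+2]· x²ⁿ[x+2]ⁿ n
x²ⁿ[x+2]ⁿ-suc n i = begin
  coeff ((X ^ₚ (2 * suc n)) ⊗ Y (suc n)) i
    ≡⟨ X^⊗ (2 * suc n) (Y (suc n)) i ⟩
  (x^ (2 * suc n) · coeff (Y (suc n))) i
    ≡⟨ cong (λ f → f i) (trans (cong (x^_· coeff (Y (suc n))) (*-suc 2 n)) (x^-+ 2 (2 * n) _)) ⟩
  (x^ 2 · (x^ (2 * n) · coeff (Y (suc n)))) i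
    ≡⟨ x^-cong 2 unfold-[x+2] i ⟩
  (x²[x+2]· x²ⁿ[x+2]ⁿ n) i ∎
  where
  Y : ℕ → Poly
  Y k = (X ⊕ (2 ∷ [])) ^ₚ k
  unfold-[x+2] : x^ (2 * n) · coeff (Y (suc n)) ≗ λ j → 2 * x²ⁿ[x+2]ⁿ n j + (x· x²ⁿ[x+2]ⁿ n) j
  unfold-[x+2] j = begin
    (x^ (2 * n) · coeff (Y (suc n))) j
      ≡⟨ x^-cong (2 * n) ([X+2]⊗ (Y n)) j ⟩
    (x^ (2 * n) · (λ l → 2 * coeff (Y n) l + (x· coeff (Y n)) l)) j
      ≡⟨ x^-linear (2 * n) 2 (coeff (Y n)) (x· coeff (Y n)) j ⟩
    2 * (x^ (2 * n) · coeff (Y n)) j + (x^ (2 * n) · (x· coeff (Y n))) j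
      ≡⟨ cong₂ (λ s t → 2 * s + t) (sym (X^⊗ (2 * n) (Y n) j))
               (trans (cong (λ f → f j) (x^-x· (2 * n) (coeff (Y n)))) (x·-cong (λ l → sym (X^⊗ (2 * n) (Y n) l)) j)) ⟩
    2 * x²ⁿ[x+2]ⁿ n j + (x· x²ⁿ[x+2]ⁿ n) j ∎

-- Sums over subsets

∑ᴮ : (Bool → ℕ) → ℕ
∑ᴮ g = g false + g true

∑ : (m : ℕ) → (Subset m → ℕ) → ℕ
∑ zero    f = f []
∑ (suc m) f = ∑ᴮ λ x → ∑ m (λ D → f (x ∷ D))

∑ᴮ-cong : ∀ {g h} → g ≗ h → ∑ᴮ g ≡ ∑ᴮ h
∑ᴮ-cong g≗h = cong₂ _+_ (g≗h false) (g≗h true)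

∑-cong : ∀ m {f g} → f ≗ g → ∑ m f ≡ ∑ m g
∑-cong zero    f≗g = f≗g []
∑-cong (suc m) f≗g = ∑ᴮ-cong λ x → ∑-cong m (λ D → f≗g (x ∷ D))

∑-zero : ∀ m {f} → f ≗ (λ _ → 0) → ∑ m f ≡ 0
∑-zero zero    f≗0 = f≗0 []
∑-zero (suc m) f≗0 = cong₂ _+_ (∑-zero m (λ D → f≗0 (false ∷ D))) (∑-zero m (λ D → f≗0 (true ∷ D)))

∑-+ : ∀ m f g → ∑ m (λ D → f D + g D) ≡ ∑ m f + ∑ m g
∑-+ zero    f g = refl
∑-+ (suc m) f g =
  trans (cong₂ _+_ (∑-+ m (λ D → f (false ∷ D)) (λ D → g (false ∷ D)))
                   (∑-+ m (λ D → f (true ∷ D)) (λ D → g (true ∷ D))))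
        (interchange (∑ m (λ D → f (false ∷ D))) _ (∑ m (λ D → f (true ∷ D))) _)

∑-∑ᴮ : ∀ m (g : Subset m → Bool → ℕ) → ∑ m (λ D → ∑ᴮ (g D)) ≡ ∑ᴮ (λ x → ∑ m (λ D → g D x))
∑-∑ᴮ m g = ∑-+ m (λ D → g D false) (λ D → g D true)

∑-*ˡ : ∀ m c f → ∑ m (λ D → c * f D) ≡ c * ∑ m f
∑-*ˡ zero    c f = refl
∑-*ˡ (suc m) c f =
  trans (cong₂ _+_ (∑-*ˡ m c (λ D → f (false ∷ D))) (∑-*ˡ m c (λ D → f (true ∷ D))))
        (sym (*-distribˡ-+ c _ _))

∑-x^ : ∀ m k (f : Subset m → Seq) i → ∑ m (λ D → (x^ k · f D) i) ≡ (x^ k · (λ j → ∑ m (λ D → f D j))) i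
∑-x^ m zero    f i       = refl
∑-x^ m (suc k) f zero    = ∑-zero m (λ D → refl)
∑-x^ m (suc k) f (suc i) = ∑-x^ m k f i

∑-++ : ∀ k l (f : Subset (k + l) → ℕ) → ∑ (k + l) f ≡ ∑ k (λ u → ∑ l (λ w → f (u ++ w)))
∑-++ zero    l f = refl
∑-++ (suc k) l f = ∑ᴮ-cong λ x → ∑-++ k l (λ D → f (x ∷ D))

countB-++ : ∀ {I : Set} (p : I → Bool) xs ys → countB p (xs ++ₗ ys) ≡ countB p xs + countB p ys
countB-++ p []       ys = refl
countB-++ p (x ∷ xs) ys with p x
... | true  = cong suc (countB-++ p xs ys)
... | false = countB-++ p xs ys

countB-map : ∀ {I J : Set} (p : J → Bool) (g : I → J) xs → countB p (map g xs) ≡ countB (λ x → p (g x)) xs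
countB-map p g []       = refl
countB-map p g (x ∷ xs) with p (g x)
... | true  = cong suc (countB-map p g xs)
... | false = countB-map p g xs

countB-allSubsets : ∀ m (p : Subset m → Bool) → countB p (allSubsets m) ≡ ∑ m (λ D → ⟦ p D ⟧)
countB-allSubsets zero    p with p []
... | true  = refl
... | false = refl
countB-allSubsets (suc m) p = begin
  countB p (map (false ∷_) S ++ₗ map (true ∷_) S)          ≡⟨ countB-++ p (map (false ∷_) S) (map (true ∷_) S) ⟩
  countB p (map (false ∷_) S) + countB p (map (true ∷_) S) ≡⟨ cong₂ _+_ (on false) (on true) ⟩
  ∑ (suc m) (λ D → ⟦ p D ⟧)                                ∎
  where
  S = allSubsets m
  on : ∀ x → countB p (map (x ∷_) S) ≡ ∑ m (λ D → ⟦ p (x ∷ D) ⟧)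
  on x = trans (countB-map p (x ∷_) S) (countB-allSubsets m (λ D → p (x ∷ D)))

∑³ : (n : ℕ) → (Subset n → Subset n → Subset n → ℕ) → ℕ
∑³ n f = ∑ n λ v → ∑ n λ a → ∑ n λ b → f v a b

∑³-cong : ∀ n {f g : Subset n → Subset n → Subset n → ℕ} → (∀ v a b → f v a b ≡ g v a b) → ∑³ n f ≡ ∑³ n g
∑³-cong n f≗g = ∑-cong n λ v → ∑-cong n λ a → ∑-cong n λ b → f≗g v a b

∑³-*ˡ : ∀ n c f → ∑³ n (λ v a b → c * f v a b) ≡ c * ∑³ n f
∑³-*ˡ n c f =
  trans (∑-cong n λ v → trans (∑-cong n λ a → ∑-*ˡ n c (f v a)) (∑-*ˡ n c _)) (∑-*ˡ n c _)

∑³-x^ : ∀ n k (f : Subset n → Subset n → Subset n → Seq) i →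
        ∑³ n (λ v a b → (x^ k · f v a b) i) ≡ (x^ k · (λ j → ∑³ n (λ v a b → f v a b j))) i
∑³-x^ n k f i =
  trans (∑-cong n λ v → trans (∑-cong n λ a → ∑-x^ n k (f v a) i) (∑-x^ n k _ i)) (∑-x^ n k _ i)

∑³-∷ : ∀ n t → ∑³ (suc n) t ≡ ∑ᴮ λ x → ∑ᴮ λ y → ∑ᴮ λ z → ∑³ n (λ v a b → t (x ∷ v) (y ∷ a) (z ∷ b))
∑³-∷ n t = ∑ᴮ-cong λ x → begin
  ∑ n (λ v → ∑ᴮ λ y → ∑ n λ a → ∑ᴮ λ z → S x y z v a)   ≡⟨ ∑-cong n (λ v → ∑ᴮ-cong λ y → ∑-∑ᴮ n (λ a z → S x y z v a)) ⟩
  ∑ n (λ v → ∑ᴮ λ y → ∑ᴮ λ z → ∑ n λ a → S x y z v a)   ≡⟨ ∑-∑ᴮ n (λ v y → ∑ᴮ λ z → ∑ n λ a → S x y z v a) ⟩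
  (∑ᴮ λ y → ∑ n λ v → ∑ᴮ λ z → ∑ n λ a → S x y z v a)   ≡⟨ ∑ᴮ-cong (λ y → ∑-∑ᴮ n (λ v z → ∑ n λ a → S x y z v a)) ⟩
  (∑ᴮ λ y → ∑ᴮ λ z → ∑ n λ v → ∑ n λ a → S x y z v a)   ∎
  where
  S : Bool → Bool → Bool → Subset n → Subset n → ℕ
  S x y z v a = ∑ n λ b → t (x ∷ v) (y ∷ a) (z ∷ b)

-- Triples of subsets satisfying a condition at every index

card-∷ : ∀ {m} x (D : Subset m) → card (x ∷ D) ≡ ⟦ x ⟧ + card D
card-∷ true  D = refl
card-∷ false D = refl

card-++ : ∀ {k l} (u : Subset k) (w : Subset l) → card (u ++ w) ≡ card u + card w
card-++ []          w = refl
card-++ (true ∷ u)  w = cong suc (card-++ u w)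
card-++ (false ∷ u) w = card-++ u w

card≤ : ∀ {m} (D : Subset m) → card D ≤ m
card≤ []          = z≤n
card≤ (true ∷ D)  = s≤s (card≤ D)
card≤ (false ∷ D) = m≤n⇒m≤1+n (card≤ D)

card³ : ∀ {m} → Subset m → Subset m → Subset m → ℕ
card³ v a b = card v + (card a + card b)

card³-∷ : ∀ {m} x y z (v a b : Subset m) → card³ (x ∷ v) (y ∷ a) (z ∷ b) ≡ (⟦ x ⟧ + (⟦ y ⟧ + ⟦ z ⟧)) + card³ v a b
card³-∷ x y z v a b = begin
  card (x ∷ v) + (card (y ∷ a) + card (z ∷ b))
    ≡⟨ cong₂ _+_ (card-∷ x v) (cong₂ _+_ (card-∷ y a) (card-∷ z b)) ⟩
  (⟦ x ⟧ + card v) + ((⟦ y ⟧ + card a) + (⟦ z ⟧ + card b))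
    ≡⟨ cong ((⟦ x ⟧ + card v) +_) (interchange ⟦ y ⟧ (card a) ⟦ z ⟧ (card b)) ⟩
  (⟦ x ⟧ + card v) + ((⟦ y ⟧ + ⟦ z ⟧) + (card a + card b))
    ≡⟨ interchange ⟦ x ⟧ (card v) (⟦ y ⟧ + ⟦ z ⟧) (card a + card b) ⟩
  (⟦ x ⟧ + (⟦ y ⟧ + ⟦ z ⟧)) + card³ v a b ∎

⟦∧⟧ : ∀ b c → ⟦ b ∧ c ⟧ ≡ ⟦ b ⟧ * ⟦ c ⟧
⟦∧⟧ true  c = sym (*-identityˡ ⟦ c ⟧)
⟦∧⟧ false c = refl

everywhere : ∀ {n} → (Bool → Bool → Bool → Bool) → Subset n → Subset n → Subset n → Bool
everywhere φ v a b = allFin λ j → φ (lookup v j) (lookup a j) (lookup b j)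

genFun³ : (Bool → Bool → Bool → Bool) → ℕ → Seq
genFun³ φ n i = ∑³ n λ v a b → δ (card³ v a b) i * ⟦ everywhere φ v a b ⟧

genFun³-suc : ∀ φ n i →
  genFun³ φ (suc n) i ≡ ∑ᴮ λ x → ∑ᴮ λ y → ∑ᴮ λ z → ⟦ φ x y z ⟧ * (x^ (⟦ x ⟧ + (⟦ y ⟧ + ⟦ z ⟧)) · genFun³ φ n) i
genFun³-suc φ n i =
  trans (∑³-∷ n (λ v a b → δ (card³ v a b) i * ⟦ everywhere φ v a b ⟧)) (∑ᴮ-cong λ x → ∑ᴮ-cong λ y → ∑ᴮ-cong λ z → begin
    ∑³ n (λ v a b → δ (card³ (x ∷ v) (y ∷ a) (z ∷ b)) i * ⟦ φ x y z ∧ E v a b ⟧)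
      ≡⟨ ∑³-cong n (λ v a b → term x y z v a b) ⟩
    ∑³ n (λ v a b → ⟦ φ x y z ⟧ * (x^ w x y z · (λ j → δ (card³ v a b) j * ⟦ E v a b ⟧)) i)
      ≡⟨ ∑³-*ˡ n ⟦ φ x y z ⟧ _ ⟩
    ⟦ φ x y z ⟧ * ∑³ n (λ v a b → (x^ w x y z · (λ j → δ (card³ v a b) j * ⟦ E v a b ⟧)) i)
      ≡⟨ cong (⟦ φ x y z ⟧ *_) (∑³-x^ n (w x y z) (λ v a b j → δ (card³ v a b) j * ⟦ E v a b ⟧) i) ⟩
    ⟦ φ x y z ⟧ * (x^ w x y z · genFun³ φ n) i ∎)
  where
  E : Subset n → Subset n → Subset n → Bool
  E = everywhere φ
  w : Bool → Bool → Bool → ℕ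
  w x y z = ⟦ x ⟧ + (⟦ y ⟧ + ⟦ z ⟧)
  term : ∀ x y z v a b →
    δ (card³ (x ∷ v) (y ∷ a) (z ∷ b)) i * ⟦ φ x y z ∧ E v a b ⟧ ≡
    ⟦ φ x y z ⟧ * (x^ w x y z · (λ j → δ (card³ v a b) j * ⟦ E v a b ⟧)) i
  term x y z v a b = begin
    δ (card³ (x ∷ v) (y ∷ a) (z ∷ b)) i * ⟦ φ x y z ∧ E v a b ⟧
      ≡⟨ cong₂ _*_ (cong (λ c → δ c i) (card³-∷ x y z v a b)) (⟦∧⟧ (φ x y z) (E v a b)) ⟩
    δ (w x y z + card³ v a b) i * (⟦ φ x y z ⟧ * ⟦ E v a b ⟧)
      ≡⟨ x∙yz≈y∙xz (δ (w x y z + card³ v a b) i) ⟦ φ x y z ⟧ ⟦ E v a b ⟧ ⟩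
    ⟦ φ x y z ⟧ * (δ (w x y z + card³ v a b) i * ⟦ E v a b ⟧)
      ≡⟨ cong (λ s → ⟦ φ x y z ⟧ * (s * ⟦ E v a b ⟧)) (δ-+ (w x y z) (card³ v a b) i) ⟩
    ⟦ φ x y z ⟧ * ((x^ w x y z · δ (card³ v a b)) i * ⟦ E v a b ⟧)
      ≡⟨ cong (⟦ φ x y z ⟧ *_) (x^-*ʳ (w x y z) (δ (card³ v a b)) ⟦ E v a b ⟧ i) ⟩
    ⟦ φ x y z ⟧ * (x^ w x y z · (λ j → δ (card³ v a b) j * ⟦ E v a b ⟧)) i ∎

pendantCondition : Bool → Bool → Bool → Bool
pendantCondition v a b = a ∧ (v ∨ b)

genFun³-pendant-suc : ∀ n → genFun³ pendantCondition (suc n) ≗ x²[x+2]· genFun³ pendantCondition n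
genFun³-pendant-suc n i = begin
  genFun³ pendantCondition (suc n) i
    ≡⟨ genFun³-suc pendantCondition n i ⟩
  -- only the local choices (x, y, z) = (0,1,1), (1,1,0), (1,1,1) survive
  1 * (x^ 2 · f) i + (1 * (x^ 2 · f) i + 1 * (x^ 3 · f) i)
    ≡⟨ collect ((x^ 2 · f) i) ((x^ 3 · f) i) ⟩
  2 * (x^ 2 · f) i + (x^ 2 · x· f) i
    ≡⟨ sym (x^-linear 2 2 f (x· f) i) ⟩
  (x²[x+2]· f) i ∎
  where
  f : Seq
  f = genFun³ pendantCondition n
  collect : ∀ s t → 1 * s + (1 * s + 1 * t) ≡ 2 * s + t
  collect = solve-∀

genFun³-pendant : ∀ n → genFun³ pendantCondition n ≗ x²ⁿ[x+2]ⁿ n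
genFun³-pendant zero    zero    = refl
genFun³-pendant zero    (suc i) = refl
genFun³-pendant (suc n) i       = begin
  genFun³ pendantCondition (suc n) i       ≡⟨ genFun³-pendant-suc n i ⟩
  (x²[x+2]· genFun³ pendantCondition n) i  ≡⟨ x^-cong 2 (λ j → cong₂ (λ s t → 2 * s + t) (genFun³-pendant n j)
                                                         (x·-cong (genFun³-pendant n) j)) i ⟩
  (x²[x+2]· x²ⁿ[x+2]ⁿ n) i                 ≡⟨ sym (x²ⁿ[x+2]ⁿ-suc n i) ⟩
  x²ⁿ[x+2]ⁿ (suc n) i                      ∎

-- Total domination in H(3)

allFin-cong : ∀ {m} {f g : Fin m → Bool} → f ≗ g → allFin f ≡ allFin g
allFin-cong {zero}  f≗g = refl
allFin-cong {suc m} f≗g = cong₂ _∧_ (f≗g zero) (allFin-cong (λ i → f≗g (suc i)))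

anyFin-cong : ∀ {m} {f g : Fin m → Bool} → f ≗ g → anyFin f ≡ anyFin g
anyFin-cong {zero}  f≗g = refl
anyFin-cong {suc m} f≗g = cong₂ _∨_ (f≗g zero) (anyFin-cong (λ i → f≗g (suc i)))

allFin-++ : ∀ k l (f : Fin (k + l) → Bool) → allFin f ≡ allFin (λ i → f (i ↑ˡ l)) ∧ allFin (λ j → f (k ↑ʳ j))
allFin-++ zero    l f = refl
allFin-++ (suc k) l f =
  trans (cong (f zero ∧_) (allFin-++ k l (λ i → f (suc i)))) (sym (∧-assoc (f zero) _ _))

anyFin-++ : ∀ k l (f : Fin (k + l) → Bool) → anyFin f ≡ anyFin (λ i → f (i ↑ˡ l)) ∨ anyFin (λ j → f (k ↑ʳ j))
anyFin-++ zero    l f = refl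
anyFin-++ (suc k) l f =
  trans (cong (f zero ∨_) (anyFin-++ k l (λ i → f (suc i)))) (sym (∨-assoc (f zero) _ _))

allFin-∧ : ∀ {m} (f g : Fin m → Bool) → allFin f ∧ allFin g ≡ allFin (λ i → f i ∧ g i)
allFin-∧ {zero}  f g = refl
allFin-∧ {suc m} f g with f zero | g zero
... | true  | true  = allFin-∧ (λ i → f (suc i)) (λ i → g (suc i))
... | true  | false = ∧-zeroʳ _
... | false | _     = refl

anyFin-∧-false : ∀ {m} (w : Subset m) → anyFin (λ j → lookup w j ∧ false) ≡ false
anyFin-∧-false []      = refl
anyFin-∧-false (x ∷ w) = cong₂ _∨_ (∧-zeroʳ x) (anyFin-∧-false w)

anyFin-select : ∀ {m} (w : Subset m) (i : Fin m) → anyFin (λ j → lookup w j ∧ eqF i j) ≡ lookup w i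
anyFin-select (x ∷ w) zero    =
  trans (cong₂ _∨_ (∧-identityʳ x) (anyFin-∧-false w)) (∨-identityʳ x)
anyFin-select (x ∷ w) (suc i) =
  trans (cong₂ _∨_ (∧-zeroʳ x) (anyFin-cong λ j → cong (lookup w j ∧_) (⌊⌋-map′ _ _ _)))
        (anyFin-select w i)

∨∧-absorb : ∀ α a c → (α ∨ a) ∧ (c ∧ a) ≡ a ∧ c
∨∧-absorb α true  c rewrite ∨-zeroʳ α = ∧-identityʳ c
∨∧-absorb α false c rewrite ∧-zeroʳ c = ∧-zeroʳ (α ∨ false)

module _ {n : ℕ} where

  inV inA inB : Fin n → Fin (n + (n + n))
  inV i = i ↑ˡ (n + n)
  inA i = n ↑ʳ (i ↑ˡ n)
  inB i = n ↑ʳ (n ↑ʳ i)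

  kind-inV : ∀ i → kind (inV i) ≡ V i
  kind-inV i rewrite splitAt-↑ˡ n i (n + n) = refl

  kind-inA : ∀ i → kind (inA i) ≡ A i
  kind-inA i rewrite splitAt-↑ʳ n (n + n) (i ↑ˡ n) | splitAt-↑ˡ n i n = refl

  kind-inB : ∀ i → kind (inB i) ≡ B i
  kind-inB i rewrite splitAt-↑ʳ n (n + n) (n ↑ʳ i) | splitAt-↑ʳ n n i = refl

  module _ (v a b : Subset n) where

    lookup-inV : ∀ i → lookup (v ++ (a ++ b)) (inV i) ≡ lookup v i
    lookup-inV = lookup-++ˡ v (a ++ b)

    lookup-inA : ∀ i → lookup (v ++ (a ++ b)) (inA i) ≡ lookup a i
    lookup-inA i = trans (lookup-++ʳ v (a ++ b) (i ↑ˡ n)) (lookup-++ˡ a b i)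

    lookup-inB : ∀ i → lookup (v ++ (a ++ b)) (inB i) ≡ lookup b i
    lookup-inB i = trans (lookup-++ʳ v (a ++ b) (n ↑ʳ i)) (lookup-++ʳ a b i)

  allFin-blocks : (f : Fin (n + (n + n)) → Bool) →
    allFin f ≡ allFin (λ i → f (inV i)) ∧ (allFin (λ i → f (inA i)) ∧ allFin (λ i → f (inB i)))
  allFin-blocks f = trans (allFin-++ n (n + n) f) (cong (allFin (λ i → f (inV i)) ∧_) (allFin-++ n n (λ y → f (n ↑ʳ y))))

  anyFin-blocks : (f : Fin (n + (n + n)) → Bool) →
    anyFin f ≡ anyFin (λ i → f (inV i)) ∨ (anyFin (λ i → f (inA i)) ∨ anyFin (λ i → f (inB i)))
  anyFin-blocks f = trans (anyFin-++ n (n + n) f) (cong (anyFin (λ i → f (inV i)) ∨_) (anyFin-++ n n (λ y → f (n ↑ʳ y))))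

H3-totalDominating : ∀ {n} (H : Graph n) (v a b : Subset n) →
  isTotalDominating (H3 H) (v ++ (a ++ b)) ≡ everywhere pendantCondition v a b
H3-totalDominating {n} H v a b = begin
  allFin (λ x → N (kind x))
    ≡⟨ allFin-blocks {n} (λ x → N (kind x)) ⟩
  allFin {n} (λ i → N (kind (inV i))) ∧ (allFin {n} (λ i → N (kind (inA i))) ∧ allFin {n} (λ i → N (kind (inB i))))
    ≡⟨ cong₂ _∧_ (allFin-cong (λ i → trans (cong N (kind-inV i)) (N-V i)))
                 (cong₂ _∧_ (allFin-cong (λ i → trans (cong N (kind-inA i)) (N-A i)))
                            (allFin-cong (λ i → trans (cong N (kind-inB i)) (N-B i)))) ⟩
  allFin (λ i → α i ∨ lookup a i) ∧ (allFin (λ i → lookup v i ∨ lookup b i) ∧ allFin (lookup a))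
    ≡⟨ cong (allFin (λ i → α i ∨ lookup a i) ∧_) (allFin-∧ (λ i → lookup v i ∨ lookup b i) (lookup a)) ⟩
  allFin (λ i → α i ∨ lookup a i) ∧ allFin (λ i → (lookup v i ∨ lookup b i) ∧ lookup a i)
    ≡⟨ allFin-∧ (λ i → α i ∨ lookup a i) (λ i → (lookup v i ∨ lookup b i) ∧ lookup a i) ⟩
  allFin (λ i → (α i ∨ lookup a i) ∧ ((lookup v i ∨ lookup b i) ∧ lookup a i))
    ≡⟨ allFin-cong (λ i → ∨∧-absorb (α i) (lookup a i) (lookup v i ∨ lookup b i)) ⟩
  everywhere pendantCondition v a b ∎
  where
  α : Fin n → Bool
  α i = anyFin (λ j → lookup v j ∧ adj H i j)
  N : Kind n → Bool
  N x = anyFin (λ u → lookup (v ++ (a ++ b)) u ∧ adjK H x (kind u))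
  N-blocks : ∀ x → N x ≡ anyFin (λ j → lookup v j ∧ adjK H x (V j))
                       ∨ (anyFin (λ j → lookup a j ∧ adjK H x (A j)) ∨ anyFin (λ j → lookup b j ∧ adjK H x (B j)))
  N-blocks x = trans (anyFin-blocks {n} (λ u → lookup (v ++ (a ++ b)) u ∧ adjK H x (kind u)))
    (cong₂ _∨_ (anyFin-cong (λ j → cong₂ (λ p q → p ∧ adjK H x q) (lookup-inV v a b j) (kind-inV j)))
      (cong₂ _∨_ (anyFin-cong (λ j → cong₂ (λ p q → p ∧ adjK H x q) (lookup-inA v a b j) (kind-inA j)))
                 (anyFin-cong (λ j → cong₂ (λ p q → p ∧ adjK H x q) (lookup-inB v a b j) (kind-inB j)))))
  N-V : ∀ i → N (V i) ≡ α i ∨ lookup a i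
  N-V i = trans (N-blocks (V i)) (cong (α i ∨_)
    (trans (cong₂ _∨_ (anyFin-select a i) (anyFin-∧-false b)) (∨-identityʳ _)))
  N-A : ∀ i → N (A i) ≡ lookup v i ∨ lookup b i
  N-A i = trans (N-blocks (A i))
    (cong₂ _∨_ (anyFin-select v i) (cong₂ _∨_ (anyFin-∧-false a) (anyFin-select b i)))
  N-B : ∀ i → N (B i) ≡ lookup a i
  N-B i = trans (N-blocks (B i))
    (cong₂ _∨_ (anyFin-∧-false v) (trans (cong₂ _∨_ (anyFin-select a i) (anyFin-∧-false b)) (∨-identityʳ _)))

dt≡∑ : ∀ {m} (G : Graph m) i → dt G i ≡ ∑ m (λ D → δ (card D) i * ⟦ isTotalDominating G D ⟧)
dt≡∑ {m} G i = trans (countB-allSubsets m _) (∑-cong m λ D →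
  trans (cong (λ b → ⟦ b ∧ isTotalDominating G D ⟧) (isYes≗does (card D ≟ i)))
        (⟦∧⟧ (card D ≡ᵇ i) (isTotalDominating G D)))

δ-< : ∀ {c i} → c < i → δ c i ≡ 0
δ-< {zero}  {suc i} c<i       = refl
δ-< {suc c} {suc i} (s≤s c<i) = δ-< c<i

dt-vanishes : ∀ {m} (G : Graph m) {i} → m < i → dt G i ≡ 0
dt-vanishes {m} G {i} m<i = trans (dt≡∑ G i)
  (∑-zero m (λ D → cong (_* ⟦ isTotalDominating G D ⟧) (δ-< (≤-<-trans (card≤ D) m<i))))

coeff-tabulate : ∀ k (g : Seq) → (∀ i → k ≤ i → g i ≡ 0) → coeff (toList (tabulate {n = k} (λ j → g (toℕ j)))) ≗ g
coeff-tabulate zero    g g≡0 i       = sym (g≡0 i z≤n)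
coeff-tabulate (suc k) g g≡0 zero    = refl
coeff-tabulate (suc k) g g≡0 (suc i) = coeff-tabulate k (λ j → g (suc j)) (λ j k≤j → g≡0 (suc j) (s≤s k≤j)) i

coeff-Dt : ∀ {m} (G : Graph m) → coeff (Dt G) ≗ dt G
coeff-Dt {m} G = coeff-tabulate (suc m) (dt G) (λ i → dt-vanishes G)

dt-H3 : ∀ {n} (H : Graph n) → dt (H3 H) ≗ genFun³ pendantCondition n
dt-H3 {n} H i = begin
  dt (H3 H) i
    ≡⟨ dt≡∑ (H3 H) i ⟩
  ∑ (n + (n + n)) (λ D → δ (card D) i * ⟦ TD D ⟧)
    ≡⟨ ∑-++ n (n + n) _ ⟩
  ∑ n (λ v → ∑ (n + n) (λ w → δ (card (v ++ w)) i * ⟦ TD (v ++ w) ⟧))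
    ≡⟨ ∑-cong n (λ v → ∑-++ n n _) ⟩
  ∑³ n (λ v a b → δ (card (v ++ (a ++ b))) i * ⟦ TD (v ++ (a ++ b)) ⟧)
    ≡⟨ ∑³-cong n (λ v a b → cong₂ (λ c t → δ c i * ⟦ t ⟧)
                                  (trans (card-++ v (a ++ b)) (cong (card v +_) (card-++ a b)))
                                  (H3-totalDominating H v a b)) ⟩
  genFun³ pendantCondition n i ∎
  where
  TD : Subset (n + (n + n)) → Bool
  TD = isTotalDominating (H3 H)

mainTheorem1 : (n : ℕ) → n ≥ 1 → (H : Graph n) →
    (i : ℕ) → coeff (Dt (H3 H)) i ≡ coeff ((X ^ₚ (2 * n)) ⊗ ((X ⊕ (2 ∷ [])) ^ₚ n)) i
mainTheorem1 n _ H i = begin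
  coeff (Dt (H3 H)) i           ≡⟨ coeff-Dt (H3 H) i ⟩
  dt (H3 H) i                   ≡⟨ dt-H3 H i ⟩
  genFun³ pendantCondition n i  ≡⟨ genFun³-pendant n i ⟩
  x²ⁿ[x+2]ⁿ n i                 ∎
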